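{- (Rogers formula.) Let $q\in\mathbb{C}$ with $q\neq1$ be such that $[n]_q\neq 0$ for all $n\geq 1$, let $u,\alpha\in\mathbb{C}$, let $(a_n^{(\alpha)})_{n\ge0}$ be complex numbers with $a_0^{(\alpha)}\neq0$ and $\mathcal{A}_q^{\alpha}(t)=\sum_{n\ge0}a_n^{(\alpha)}\frac{t^n}{[n]_q!}$, let $\mathrm{P}_{n,q}^{(\alpha)}(x;u)$ be defined by $\mathcal{A}_q^{\alpha}(t)\mathrm{e}_q(tx,u)=\sum_{n}\mathrm{P}_{n,q}^{(\alpha)}(x;u)\frac{t^n}{[n]_q!}$, and let $\mathrm{Q}_{n,q}^{(\alpha)}(x,y,z;u)=\sum_{k=0}^{n}\genfrac{[}{]}{0pt}{}{n}{k}_{q}\mathrm{P}_{k,q}^{(\alpha)}(x;u)y^kz^{n-k}$. Then, as formal power series in $t,s$, $$\sum_{n=0}^{\infty}\sum_{m=0}^{\infty}\mathrm{Q}_{n+m,q}^{(\alpha)}(x,y,z;u)\frac{t^n}{[n]_q!}\frac{s^m}{[m]_q!}=\mathrm{e}_q(zt)\mathrm{e}_q(zs)\sum_{n=0}^{\infty}\frac{\mathrm{P}_{n,q}^{(\alpha)}(x;u)y^n}{[n]_q!}\sum_{k=0}^{n}\genfrac{[}{]}{0pt}{}{n}{k}_{q}t^ks^{n-k}((1-q)zs;q)_k.$$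
   Context: $[n]_q=\frac{1-q^n}{1-q}$, $[n]_q!=[1]_q\cdots[n]_q$ ($[0]_q!=1$), $\genfrac{[}{]}{0pt}{}{n}{k}_{q}=\frac{[n]_q!}{[k]_q![n-k]_q!}$. $\mathrm{e}_q(z,u)=\sum_{n\ge0}u^{\binom{n}{2}}\frac{z^n}{[n]_q!}$ (convention $0^0=1$), $\mathrm{e}_q(z)=\mathrm{e}_q(z,1)$. $(a;q)_0=1$, $(a;q)_k=\prod_{j=0}^{k-1}(1-q^ja)$. -}

module Defs where

open import Level using (Level; _⊔_) renaming (suc to lsuc)
open import Data.Nat as ℕ using (ℕ; zero; suc; _∸_)
open import Data.Nat.Combinatorics using (_C_)
open import Data.Bool using (if_then_else_; _∧_)
open import Relation.Nullary using (¬_)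
open import Algebra.Bundles using (CommutativeRing)

-- A field: a commutative ring with 0 ≠ 1 and a (total) inverse map
-- that is a genuine inverse on nonzero elements (value at 0 irrelevant).
record Field (c ℓ : Level) : Set (lsuc (c ⊔ ℓ)) where
  field
    commutativeRing : CommutativeRing c ℓ
  open CommutativeRing commutativeRing public
  field
    _⁻¹       : Carrier → Carrier
    ⁻¹-inverse : ∀ x → ¬ (x ≈ 0#) → x * (x ⁻¹) ≈ 1#
    0≉1        : ¬ (0# ≈ 1#)

module FieldDefs {c ℓ : Level} (F : Field c ℓ) where
  open Field F

  pow : Carrier → ℕ → Carrier
  pow x zero    = 1#
  pow x (suc n) = x * pow x n

  sumBelow : ℕ → (ℕ → Carrier) → Carrier
  sumBelow zero    f = 0#
  sumBelow (suc n) f = sumBelow n f + f n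

  sumTo : ℕ → (ℕ → Carrier) → Carrier
  sumTo n f = sumBelow (suc n) f

  qint : Carrier → ℕ → Carrier
  qint q n = (1# - pow q n) * ((1# - q) ⁻¹)

  qfact : Carrier → ℕ → Carrier
  qfact q zero    = 1#
  qfact q (suc n) = qfact q n * qint q (suc n)

  qbinom : Carrier → ℕ → ℕ → Carrier
  qbinom q n k = qfact q n * ((qfact q k) ⁻¹) * ((qfact q (n ∸ k)) ⁻¹)

  qpoch : Carrier → Carrier → ℕ → Carrier
  qpoch a q zero    = 1#
  qpoch a q (suc k) = qpoch a q k * (1# - pow q k * a)

  Series : Set c
  Series = ℕ → Carrier

  _·_ : Series → Series → Series
  (f · g) n = sumTo n (λ k → f k * g (n ∸ k))

  -- e_q(c t, u) = Σ_n u^{binom n 2} c^n t^n / [n]_q!  (as a series in t)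
  eqSeries : Carrier → Carrier → Carrier → Series
  eqSeries q c u n = pow u (n C 2) * pow c n * ((qfact q n) ⁻¹)

  -- Formal power series in two variables t, s: f i j = coeff of t^i s^j.
  Series2 : Set c
  Series2 = ℕ → ℕ → Carrier

  _⊗_ : Series2 → Series2 → Series2
  (f ⊗ g) i j = sumTo i (λ a → sumTo j (λ b → f a b * g (i ∸ a) (j ∸ b)))

  _⊕_ : Series2 → Series2 → Series2
  (f ⊕ g) i j = f i j + g i j

  scale : Carrier → Series2 → Series2
  scale c f i j = c * f i j

  mono : Carrier → ℕ → ℕ → Series2
  mono c a b i j = if (i ℕ.≡ᵇ a) ∧ (j ℕ.≡ᵇ b) then c else 0#

  inT : Series → Series2
  inT f i j = if j ℕ.≡ᵇ 0 then f i else 0#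

  inS : Series → Series2
  inS f i j = if i ℕ.≡ᵇ 0 then f j else 0#

  sumTo2 : ℕ → (ℕ → Series2) → Series2
  sumTo2 n F i j = sumTo n (λ k → F k i j)

  -- infinite sum Σ_{n≥0} F n, for families where F n only has monomials
  -- of total degree ≥ n (so the coefficient of t^i s^j only receives
  -- contributions from n ≤ i + j)
  sumFam2 : (ℕ → Series2) → Series2
  sumFam2 F i j = sumTo (i ℕ.+ j) (λ n → F n i j)

  qpochS : Carrier → Carrier → ℕ → Series2
  qpochS b q zero    = mono 1# 0 0
  qpochS b q (suc k) = qpochS b q k ⊗ (mono 1# 0 0 ⊕ mono (- (pow q k * b)) 0 1)

-- Compare coefficients of tⁱ sʲ. Every factor on the right-hand side is separable (a series in t
-- times a series in s), and iterating the q-difference equation e_q(ws) (1 − (1−q)ws) = e_q(qws)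
-- gives e_q(zs) ((1−q)zs; q)ₖ = e_q(qᵏzs). So the (n, k) summand contributes
--   Pₙ yⁿ/[n]_q! · [n k]_q · z^(i−k)/[i−k]_q! · (qᵏz)^(j−n+k)/[j−n+k]_q!
--     = Pₙ yⁿ z^(i+j−n)/([i]_q! [j]_q!) · q^(k(j−n+k)) [i k]_q [j n−k]_q,
-- and the q-Vandermonde identity  Σₖ q^(k(j−n+k)) [i k]_q [j n−k]_q = [i+j n]_q  turns the sum
-- over k into the coefficient  Σₙ [i+j n]_q Pₙ yⁿ z^(i+j−n)/([i]_q! [j]_q!)  of the left-hand side.

{-# OPTIONS --safe #-}
module Submission where

open import Level using (Level)
open import Defs
open import Data.Nat as ℕ using (ℕ; zero; suc; _≤_; _<_; _∸_; z≤n; s≤s)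
import Data.Nat.Properties as ℕₚ
open import Data.Nat.Combinatorics using (_C_)
open import Data.Bool using (true; false; if_then_else_)
open import Data.Sum using (inj₁; inj₂)
open import Relation.Nullary using (¬_)
import Relation.Binary.PropositionalEquality as ≡

[i+j]∸n≡[i∸k]+[j∸[n∸k]] : ∀ {i j n k} → k ≤ i → k ≤ n → n ∸ k ≤ j →
                          (i ℕ.+ j) ∸ n ≡.≡ (i ∸ k) ℕ.+ (j ∸ (n ∸ k))
[i+j]∸n≡[i∸k]+[j∸[n∸k]] {i} {j} {n} {k} k≤i k≤n l≤j = begin
  (i ℕ.+ j) ∸ n                ≡⟨ ≡.cong ((i ℕ.+ j) ∸_) (≡.sym (ℕₚ.m+[n∸m]≡n k≤n)) ⟩
  (i ℕ.+ j) ∸ (k ℕ.+ (n ∸ k))  ≡⟨ ≡.sym (ℕₚ.∸-+-assoc (i ℕ.+ j) k (n ∸ k)) ⟩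
  (i ℕ.+ j) ∸ k ∸ (n ∸ k)      ≡⟨ ≡.cong (_∸ (n ∸ k)) (ℕₚ.+-∸-comm j k≤i) ⟩
  (i ∸ k ℕ.+ j) ∸ (n ∸ k)      ≡⟨ ℕₚ.+-∸-assoc (i ∸ k) l≤j ⟩
  (i ∸ k) ℕ.+ (j ∸ (n ∸ k))    ∎
  where open ≡.≡-Reasoning

i+j<n⇒j<n∸i : ∀ {i j n} → i ℕ.+ j < n → j < n ∸ i
i+j<n⇒j<n∸i {i} {j} {n} i+j<n =
  ℕₚ.m+n≤o⇒m≤o∸n (suc j) (≡.subst (_< n) (ℕₚ.+-comm i j) i+j<n)

module _ {c ℓ : Level} (F : Field c ℓ) where
  open Field F hiding (zero)
  open FieldDefs F
  open import Relation.Binary.Reasoning.Setoid setoid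
  open import Algebra.Properties.Ring ring using (-‿distribˡ-*; x[y-z]≈xy-xz)
  open import Algebra.Properties.AbelianGroup +-abelianGroup
    using (⁻¹-anti-homo‿-; xyx⁻¹≈y; x∙y⁻¹≈ε⇒x≈y)
  open import Algebra.Properties.CommutativeSemigroup *-commutativeSemigroup
    using (x∙yz≈y∙xz; xy∙z≈zx∙y; interchange)
  open import Algebra.Properties.CommutativeSemigroup +-commutativeSemigroup
    using () renaming (interchange to +-interchange)
  open import Algebra.Solver.Ring.NaturalCoefficients.Default commutativeSemiring
    using (solve; _:+_; _:*_; _:=_)

  x≈0⇒x*y≈0 : ∀ {x} y → x ≈ 0# → x * y ≈ 0#
  x≈0⇒x*y≈0 y x≈0 = trans (*-congʳ x≈0) (zeroˡ y)

  y≈0⇒x*y≈0 : ∀ x {y} → y ≈ 0# → x * y ≈ 0#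
  y≈0⇒x*y≈0 x y≈0 = trans (*-congˡ y≈0) (zeroʳ x)

  x≉0∧y≉0⇒x*y≉0 : ∀ {x y} → ¬ x ≈ 0# → ¬ y ≈ 0# → ¬ x * y ≈ 0#
  x≉0∧y≉0⇒x*y≉0 {x} {y} x≉0 y≉0 xy≈0 = x≉0 (begin
    x                ≈⟨ sym (*-identityʳ x) ⟩
    x * 1#           ≈⟨ *-congˡ (sym (⁻¹-inverse y y≉0)) ⟩
    x * (y * y ⁻¹)   ≈⟨ sym (*-assoc x y (y ⁻¹)) ⟩
    (x * y) * y ⁻¹   ≈⟨ x≈0⇒x*y≈0 (y ⁻¹) xy≈0 ⟩
    0#               ∎)

  x-[x-y]≈y : ∀ x y → x - (x - y) ≈ y
  x-[x-y]≈y x y = begin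
    x - (x - y)   ≈⟨ +-congˡ (⁻¹-anti-homo‿- x y) ⟩
    x + (y - x)   ≈⟨ sym (+-assoc x y (- x)) ⟩
    x + y - x     ≈⟨ xyx⁻¹≈y x y ⟩
    y             ∎

  1-xy≈[1-x]+x[1-y] : ∀ x y → 1# - x * y ≈ (1# - x) + x * (1# - y)
  1-xy≈[1-x]+x[1-y] x y = sym (begin
    (1# - x) + x * (1# - y)      ≈⟨ +-congˡ (trans (x[y-z]≈xy-xz x 1# y) (+-congʳ (*-identityʳ x))) ⟩
    (1# - x) + (x - x * y)       ≈⟨ +-assoc 1# (- x) (x - x * y) ⟩
    1# + (- x + (x - x * y))     ≈⟨ +-congˡ (sym (+-assoc (- x) x (- (x * y)))) ⟩
    1# + ((- x + x) - x * y)     ≈⟨ +-congˡ (+-congʳ (-‿inverseˡ x)) ⟩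
    1# + (0# - x * y)            ≈⟨ +-congˡ (+-identityˡ (- (x * y))) ⟩
    1# - x * y                   ∎)

  pow-1# : ∀ n → pow 1# n ≈ 1#
  pow-1# zero    = refl
  pow-1# (suc n) = trans (*-identityˡ _) (pow-1# n)

  pow-congˡ : ∀ {x y} n → x ≈ y → pow x n ≈ pow y n
  pow-congˡ zero    x≈y = refl
  pow-congˡ (suc n) x≈y = *-cong x≈y (pow-congˡ n x≈y)

  pow-+ : ∀ x m n → pow x (m ℕ.+ n) ≈ pow x m * pow x n
  pow-+ x zero    n = sym (*-identityˡ _)
  pow-+ x (suc m) n = trans (*-congˡ (pow-+ x m n)) (sym (*-assoc _ _ _))

  pow-* : ∀ x y n → pow (x * y) n ≈ pow x n * pow y n
  pow-* x y zero    = sym (*-identityˡ 1#)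
  pow-* x y (suc n) = trans (*-congˡ (pow-* x y n)) (interchange x y _ _)

  -- Finite sums

  sumBelow-cong : ∀ n {f g : ℕ → Carrier} → (∀ k → k < n → f k ≈ g k) →
                  sumBelow n f ≈ sumBelow n g
  sumBelow-cong zero    f≈g = refl
  sumBelow-cong (suc n) f≈g =
    +-cong (sumBelow-cong n (λ k k<n → f≈g k (ℕₚ.m<n⇒m<1+n k<n))) (f≈g n ℕₚ.≤-refl)

  sumBelow-zero : ∀ n {f : ℕ → Carrier} → (∀ k → k < n → f k ≈ 0#) → sumBelow n f ≈ 0#
  sumBelow-zero zero    f≈0 = refl
  sumBelow-zero (suc n) f≈0 = trans
    (+-cong (sumBelow-zero n (λ k k<n → f≈0 k (ℕₚ.m<n⇒m<1+n k<n))) (f≈0 n ℕₚ.≤-refl))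
    (+-identityˡ 0#)

  sumBelow-+ : ∀ n (f g : ℕ → Carrier) →
               sumBelow n (λ k → f k + g k) ≈ sumBelow n f + sumBelow n g
  sumBelow-+ zero    f g = sym (+-identityˡ 0#)
  sumBelow-+ (suc n) f g = trans (+-congʳ (sumBelow-+ n f g)) (+-interchange _ _ _ _)

  *-distribˡ-sumBelow : ∀ n a (f : ℕ → Carrier) → a * sumBelow n f ≈ sumBelow n (λ k → a * f k)
  *-distribˡ-sumBelow zero    a f = zeroʳ a
  *-distribˡ-sumBelow (suc n) a f = trans (distribˡ a _ _) (+-congʳ (*-distribˡ-sumBelow n a f))

  *-distribʳ-sumBelow : ∀ n a (f : ℕ → Carrier) → sumBelow n f * a ≈ sumBelow n (λ k → f k * a)
  *-distribʳ-sumBelow n a f = trans (*-comm _ a)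
    (trans (*-distribˡ-sumBelow n a f) (sumBelow-cong n (λ k _ → *-comm a (f k))))

  sumBelow-comm : ∀ m n (f : ℕ → ℕ → Carrier) →
    sumBelow m (λ a → sumBelow n (f a)) ≈ sumBelow n (λ b → sumBelow m (λ a → f a b))
  sumBelow-comm zero    n f = sym (sumBelow-zero n (λ _ _ → refl))
  sumBelow-comm (suc m) n f =
    trans (+-congʳ (sumBelow-comm m n f)) (sym (sumBelow-+ n _ (f m)))

  sumBelow-comm₃ : ∀ l m n (f : ℕ → ℕ → ℕ → Carrier) →
    sumBelow l (λ a → sumBelow m (λ b → sumBelow n (f a b)))
      ≈ sumBelow n (λ k → sumBelow l (λ a → sumBelow m (λ b → f a b k)))
  sumBelow-comm₃ l m n f = trans (sumBelow-cong l (λ a _ → sumBelow-comm m n (f a)))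
                                 (sumBelow-comm l n (λ a k → sumBelow m (λ b → f a b k)))

  sumBelow-head : ∀ n (f : ℕ → Carrier) → sumBelow (suc n) f ≈ f 0 + sumBelow n (λ k → f (suc k))
  sumBelow-head zero    f = trans (+-identityˡ _) (sym (+-identityʳ _))
  sumBelow-head (suc n) f = trans (+-congʳ (sumBelow-head n f)) (+-assoc _ _ _)

  sumBelow-extend : ∀ {m} n (f : ℕ → Carrier) → m ≤ n →
                    (∀ k → m ≤ k → k < n → f k ≈ 0#) → sumBelow n f ≈ sumBelow m f
  sumBelow-extend zero    f z≤n f≈0 = refl
  sumBelow-extend (suc n) f m≤n f≈0 with ℕₚ.m≤n⇒m<n∨m≡n m≤n
  ... | inj₂ ≡.refl       = refl
  ... | inj₁ (s≤s m≤n′) = trans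
    (+-cong (sumBelow-extend n f m≤n′ (λ k m≤k k<n → f≈0 k m≤k (ℕₚ.m<n⇒m<1+n k<n)))
            (f≈0 n m≤n′ ℕₚ.≤-refl))
    (+-identityʳ _)

  sumTo-reverse : ∀ n (f : ℕ → Carrier) → sumTo n f ≈ sumTo n (λ k → f (n ∸ k))
  sumTo-reverse zero    f = refl
  sumTo-reverse (suc n) f = begin
    sumTo n f + f (suc n)                  ≈⟨ +-congʳ (sumTo-reverse n f) ⟩
    sumTo n (λ k → f (n ∸ k)) + f (suc n)  ≈⟨ +-comm _ _ ⟩
    f (suc n) + sumTo n (λ k → f (n ∸ k))  ≈⟨ sym (sumBelow-head (suc n) (λ k → f (suc n ∸ k))) ⟩
    sumTo (suc n) (λ k → f (suc n ∸ k))    ∎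

  -- Power series in one variable

  δ : ℕ → Series
  δ a n = if n ℕ.≡ᵇ a then 1# else 0#

  shift : ℕ → Series → Series
  shift zero    f n       = f n
  shift (suc a) f zero    = 0#
  shift (suc a) f (suc n) = shift a f n

  shift-≤ : ∀ a f {n} → a ≤ n → shift a f n ≡.≡ f (n ∸ a)
  shift-≤ zero    f _         = ≡.refl
  shift-≤ (suc a) f (s≤s a≤n) = shift-≤ a f a≤n

  shift-< : ∀ a f {n} → n < a → shift a f n ≡.≡ 0#
  shift-< (suc a) f {zero}  _         = ≡.refl
  shift-< (suc a) f {suc n} (s≤s n<a) = shift-< a f n<a

  shift-cong : ∀ a {f g : Series} → (∀ n → f n ≈ g n) → ∀ n → shift a f n ≈ shift a g n
  shift-cong zero    f≈g n       = f≈g n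
  shift-cong (suc a) f≈g zero    = refl
  shift-cong (suc a) f≈g (suc n) = shift-cong a f≈g n

  δ≡shift : ∀ a n → δ a n ≡.≡ shift a (δ 0) n
  δ≡shift zero    n       = ≡.refl
  δ≡shift (suc a) zero    = ≡.refl
  δ≡shift (suc a) (suc n) = δ≡shift a n

  linearPoly : Carrier → Series
  linearPoly c n = δ 0 n + c * δ 1 n

  ·-cong : ∀ {f f′ g g′ : Series} → (∀ k → f k ≈ f′ k) → (∀ k → g k ≈ g′ k) →
           ∀ n → (f · g) n ≈ (f′ · g′) n
  ·-cong f≈f′ g≈g′ n = sumBelow-cong (suc n) (λ k _ → *-cong (f≈f′ k) (g≈g′ (n ∸ k)))

  ·-comm : ∀ f g n → (f · g) n ≈ (g · f) n
  ·-comm f g n = trans (sumTo-reverse n (λ k → f k * g (n ∸ k)))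
    (sumBelow-cong (suc n) (λ k k≤n →
      trans (*-comm _ _) (*-congʳ (reflexive (≡.cong g (ℕₚ.m∸[m∸n]≡n (ℕₚ.≤-pred k≤n)))))))

  ·-linearʳ : ∀ f g h c n → (f · (λ k → g k + c * h k)) n ≈ (f · g) n + c * (f · h) n
  ·-linearʳ f g h c n = begin
    sumTo n (λ k → f k * (g (n ∸ k) + c * h (n ∸ k)))
      ≈⟨ sumBelow-cong (suc n) (λ k _ →
           trans (distribˡ (f k) _ _) (+-congˡ (x∙yz≈y∙xz (f k) c _))) ⟩
    sumTo n (λ k → f k * g (n ∸ k) + c * (f k * h (n ∸ k)))
      ≈⟨ sumBelow-+ (suc n) _ _ ⟩
    (f · g) n + sumTo n (λ k → c * (f k * h (n ∸ k)))
      ≈⟨ +-congˡ (sym (*-distribˡ-sumBelow (suc n) c _)) ⟩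
    (f · g) n + c * (f · h) n ∎

  ·-identityˡ : ∀ g n → (δ 0 · g) n ≈ g n
  ·-identityˡ g n = begin
    (δ 0 · g) n
      ≈⟨ sumBelow-head n _ ⟩
    1# * g n + sumBelow n (λ k → 0# * g (n ∸ suc k))
      ≈⟨ +-cong (*-identityˡ (g n)) (sumBelow-zero n (λ k _ → zeroˡ _)) ⟩
    g n + 0#
      ≈⟨ +-identityʳ (g n) ⟩
    g n ∎

  ·-identityʳ : ∀ f n → (f · δ 0) n ≈ f n
  ·-identityʳ f n = trans (·-comm f (δ 0) n) (·-identityˡ f n)

  ·-shiftʳ : ∀ a f g n → (f · shift a g) n ≈ shift a (f · g) n
  ·-shiftʳ zero    f g n       = refl
  ·-shiftʳ (suc a) f g zero    = trans (+-identityˡ _) (zeroʳ (f 0))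
  ·-shiftʳ (suc a) f g (suc n) = begin
    sumTo n (λ k → f k * shift (suc a) g (suc n ∸ k)) + f (suc n) * shift (suc a) g (n ∸ n)
      ≈⟨ +-cong (sumBelow-cong (suc n) (λ k k≤n → *-congˡ (reflexive (≡.cong (shift (suc a) g)
                                                     (ℕₚ.+-∸-assoc 1 (ℕₚ.≤-pred k≤n))))))
                (y≈0⇒x*y≈0 (f (suc n)) (reflexive (≡.cong (shift (suc a) g) (ℕₚ.n∸n≡0 n)))) ⟩
    (f · shift a g) n + 0#  ≈⟨ +-identityʳ _ ⟩
    (f · shift a g) n       ≈⟨ ·-shiftʳ a f g n ⟩
    shift a (f · g) n       ∎

  ·-δʳ : ∀ f a n → (f · δ a) n ≈ shift a f n
  ·-δʳ f a n = begin
    (f · δ a) n             ≈⟨ ·-cong (λ _ → refl) (λ k → reflexive (δ≡shift a k)) n ⟩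
    (f · shift a (δ 0)) n   ≈⟨ ·-shiftʳ a f (δ 0) n ⟩
    shift a (f · δ 0) n     ≈⟨ shift-cong a (·-identityʳ f) n ⟩
    shift a f n             ∎

  δ-· : ∀ a g n → (δ a · g) n ≈ shift a g n
  δ-· a g n = trans (·-comm (δ a) g n) (·-δʳ g a n)

  ·-linearPoly : ∀ g c n → (g · linearPoly c) n ≈ g n + c * shift 1 g n
  ·-linearPoly g c n =
    trans (·-linearʳ g (δ 0) (δ 1) c n) (+-cong (·-identityʳ g n) (*-congˡ (·-δʳ g 1 n)))

  -- The one instance of associativity of · that is needed; it avoids reindexing a double sum.
  ·-·-linearPoly : ∀ f g c n → (f · (g · linearPoly c)) n ≈ (f · g) n + c * shift 1 (f · g) n
  ·-·-linearPoly f g c n = begin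
    (f · (g · linearPoly c)) n             ≈⟨ ·-cong (λ _ → refl) (·-linearPoly g c) n ⟩
    (f · (λ k → g k + c * shift 1 g k)) n  ≈⟨ ·-linearʳ f g (shift 1 g) c n ⟩
    (f · g) n + c * (f · shift 1 g) n      ≈⟨ +-congˡ (*-congˡ (·-shiftʳ 1 f g n)) ⟩
    (f · g) n + c * shift 1 (f · g) n      ∎

  -- Separable series in two variables

  Separable : Series2 → Series → Series → Set ℓ
  Separable A f g = ∀ i j → A i j ≈ f i * g j

  ⊗-cong : ∀ {A A′ B B′ : Series2} →
           (∀ i j → A i j ≈ A′ i j) → (∀ i j → B i j ≈ B′ i j) →
           ∀ i j → (A ⊗ B) i j ≈ (A′ ⊗ B′) i j
  ⊗-cong A≈A′ B≈B′ i j = sumBelow-cong (suc i) (λ a _ → sumBelow-cong (suc j) (λ b _ →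
    *-cong (A≈A′ a b) (B≈B′ (i ∸ a) (j ∸ b))))

  ⊗-separable : ∀ {A B f₁ g₁ f₂ g₂} → Separable A f₁ g₁ → Separable B f₂ g₂ →
                Separable (A ⊗ B) (f₁ · f₂) (g₁ · g₂)
  ⊗-separable {A} {B} {f₁} {g₁} {f₂} {g₂} A≈ B≈ i j = begin
    (A ⊗ B) i j
      ≈⟨ sumBelow-cong (suc i) (λ a _ → sumBelow-cong (suc j) (λ b _ →
           trans (*-cong (A≈ a b) (B≈ (i ∸ a) (j ∸ b))) (interchange _ _ _ _))) ⟩
    sumTo i (λ a → sumTo j (λ b → (f₁ a * f₂ (i ∸ a)) * (g₁ b * g₂ (j ∸ b))))
      ≈⟨ sumBelow-cong (suc i) (λ a _ → sym (*-distribˡ-sumBelow (suc j) _ _)) ⟩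
    sumTo i (λ a → (f₁ a * f₂ (i ∸ a)) * (g₁ · g₂) j)
      ≈⟨ sym (*-distribʳ-sumBelow (suc i) _ _) ⟩
    (f₁ · f₂) i * (g₁ · g₂) j ∎

  mono-separable : ∀ c a b → Separable (mono c a b) (δ a) (λ j → c * δ b j)
  mono-separable c a b i j with i ℕ.≡ᵇ a | j ℕ.≡ᵇ b
  ... | false | _     = sym (zeroˡ _)
  ... | true  | true  = sym (trans (*-identityˡ _) (*-identityʳ c))
  ... | true  | false = sym (trans (*-identityˡ _) (zeroʳ c))

  inT-separable : ∀ f → Separable (inT f) f (δ 0)
  inT-separable f i zero    = sym (*-identityʳ _)
  inT-separable f i (suc j) = sym (zeroʳ _)

  inS-separable : ∀ f → Separable (inS f) (δ 0) f
  inS-separable f zero    j = sym (*-identityˡ _)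
  inS-separable f (suc i) j = sym (zeroˡ _)

  ⊗-scaleʳ : ∀ (X Y : Series2) c i j → (X ⊗ scale c Y) i j ≈ c * (X ⊗ Y) i j
  ⊗-scaleʳ X Y c i j = begin
    (X ⊗ scale c Y) i j
      ≈⟨ sumBelow-cong (suc i) (λ a _ → sumBelow-cong (suc j) (λ b _ → x∙yz≈y∙xz _ c _)) ⟩
    sumTo i (λ a → sumTo j (λ b → c * (X a b * Y (i ∸ a) (j ∸ b))))
      ≈⟨ sumBelow-cong (suc i) (λ a _ → sym (*-distribˡ-sumBelow (suc j) c _)) ⟩
    sumTo i (λ a → c * sumTo j (λ b → X a b * Y (i ∸ a) (j ∸ b)))
      ≈⟨ sym (*-distribˡ-sumBelow (suc i) c _) ⟩
    c * (X ⊗ Y) i j ∎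

  ⊗-sumTo2 : ∀ (X : Series2) n (G : ℕ → Series2) i j →
             (X ⊗ sumTo2 n G) i j ≈ sumTo n (λ k → (X ⊗ G k) i j)
  ⊗-sumTo2 X n G i j = trans
    (sumBelow-cong (suc i) (λ a _ → sumBelow-cong (suc j) (λ b _ →
      *-distribˡ-sumBelow (suc n) (X a b) _)))
    (sumBelow-comm₃ (suc i) (suc j) (suc n) (λ a b k → X a b * G k (i ∸ a) (j ∸ b)))

  Summable : (ℕ → Series2) → Set ℓ
  Summable G = ∀ n i j → i ℕ.+ j < n → G n i j ≈ 0#

  sumFam2≈sumTo2 : ∀ G → Summable G → ∀ N i j → i ℕ.+ j ≤ N → sumFam2 G i j ≈ sumTo2 N G i j
  sumFam2≈sumTo2 G G≈0 N i j i+j≤N =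
    sym (sumBelow-extend (suc N) _ (s≤s i+j≤N) (λ n i+j<n _ → G≈0 n i j i+j<n))

  ⊗-sumFam2 : ∀ X G → Summable G →
              ∀ i j → (X ⊗ sumFam2 G) i j ≈ sumTo (i ℕ.+ j) (λ n → (X ⊗ G n) i j)
  ⊗-sumFam2 X G G≈0 i j = trans
    (sumBelow-cong (suc i) (λ a _ → sumBelow-cong (suc j) (λ b _ → *-congˡ
      (sumFam2≈sumTo2 G G≈0 (i ℕ.+ j) (i ∸ a) (j ∸ b)
                      (ℕₚ.+-mono-≤ (ℕₚ.m∸n≤m i a) (ℕₚ.m∸n≤m j b))))))
    (⊗-sumTo2 X (i ℕ.+ j) G i j)

  qpochSeries : Carrier → Carrier → ℕ → Series
  qpochSeries b q zero    = δ 0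
  qpochSeries b q (suc k) = qpochSeries b q k · linearPoly (- (pow q k * b))

  qpochS-separable : ∀ b q k → Separable (qpochS b q k) (δ 0) (qpochSeries b q k)
  qpochS-separable b q zero    i j = trans (mono-separable 1# 0 0 i j) (*-congˡ (*-identityˡ _))
  qpochS-separable b q (suc k) i j = trans
    (⊗-separable (qpochS-separable b q k) linearPoly-separable i j)
    (*-congʳ (·-identityʳ (δ 0) i))
    where
    linearPoly-separable : Separable (mono 1# 0 0 ⊕ mono (- (pow q k * b)) 0 1)
                                     (δ 0) (linearPoly (- (pow q k * b)))
    linearPoly-separable i j = trans
      (+-cong (mono-separable 1# 0 0 i j) (mono-separable _ 0 1 i j))
      (trans (+-congʳ (*-congˡ (*-identityˡ _))) (sym (distribˡ _ _ _)))

  -- q-integers and Gaussian binomials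

  qint-0 : ∀ q → qint q 0 ≈ 0#
  qint-0 q = x≈0⇒x*y≈0 _ (-‿inverseʳ 1#)

  qint-+ : ∀ q m n → qint q (m ℕ.+ n) ≈ qint q m + pow q m * qint q n
  qint-+ q m n = begin
    (1# - pow q (m ℕ.+ n)) * w          ≈⟨ *-congʳ (+-congˡ (-‿cong (pow-+ q m n))) ⟩
    (1# - x * y) * w                    ≈⟨ *-congʳ (1-xy≈[1-x]+x[1-y] x y) ⟩
    ((1# - x) + x * (1# - y)) * w       ≈⟨ distribʳ w _ _ ⟩
    (1# - x) * w + (x * (1# - y)) * w   ≈⟨ +-congˡ (*-assoc x _ w) ⟩
    qint q m + x * qint q n             ∎
    where
    x = pow q m
    y = pow q n
    w = (1# - q) ⁻¹

  module GaussianBinomial (q : Carrier) where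

    -- Unlike qbinom, which is junk for k > m (m ∸ k truncates to 0), gauss vanishes there.
    gauss : ℕ → ℕ → Carrier
    gauss m       zero    = 1#
    gauss zero    (suc k) = 0#
    gauss (suc m) (suc k) = gauss m (suc k) + pow q (m ∸ k) * gauss m k

    m<k⇒gauss≈0 : ∀ {m k} → m < k → gauss m k ≈ 0#
    m<k⇒gauss≈0 {zero}  {suc k} _         = refl
    m<k⇒gauss≈0 {suc m} {suc k} (s≤s m<k) = trans
      (+-cong (m<k⇒gauss≈0 (ℕₚ.m<n⇒m<1+n m<k)) (y≈0⇒x*y≈0 _ (m<k⇒gauss≈0 m<k)))
      (+-identityʳ 0#)

    gauss*qfact*qfact : ∀ {m k} → k ≤ m → gauss m k * qfact q k * qfact q (m ∸ k) ≈ qfact q m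
    gauss*qfact*qfact {m}     {zero}  _         = trans (*-congʳ (*-identityˡ 1#)) (*-identityˡ _)
    gauss*qfact*qfact {suc m} {suc k} (s≤s k≤m) = begin
      (gauss m (suc k) + pow q (m ∸ k) * gauss m k) * (qfact q k * qint q (suc k)) * qfact q (m ∸ k)
        ≈⟨ solve 6 (λ g₁ p g₀ f i f′ → (g₁ :+ p :* g₀) :* (f :* i) :* f′
                                    := g₁ :* (f :* i) :* f′ :+ (p :* i) :* (g₀ :* f :* f′))
                 refl _ _ _ _ _ _ ⟩
      gauss m (suc k) * qfact q (suc k) * qfact q (m ∸ k)
        + (pow q (m ∸ k) * qint q (suc k)) * (gauss m k * qfact q k * qfact q (m ∸ k))
        ≈⟨ +-cong first-summand (*-congˡ (gauss*qfact*qfact k≤m)) ⟩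
      qfact q m * qint q (m ∸ k) + (pow q (m ∸ k) * qint q (suc k)) * qfact q m
        ≈⟨ trans (+-congˡ (*-comm _ _)) (sym (distribˡ _ _ _)) ⟩
      qfact q m * (qint q (m ∸ k) + pow q (m ∸ k) * qint q (suc k))
        ≈⟨ *-congˡ (sym (qint-+ q (m ∸ k) (suc k))) ⟩
      qfact q m * qint q (m ∸ k ℕ.+ suc k)
        ≈⟨ *-congˡ (reflexive (≡.cong (qint q)
             (≡.trans (ℕₚ.+-suc (m ∸ k) k) (≡.cong suc (ℕₚ.m∸n+n≡m k≤m))))) ⟩
      qfact q m * qint q (suc m) ∎
      where
      first-summand : gauss m (suc k) * qfact q (suc k) * qfact q (m ∸ k) ≈ qfact q m * qint q (m ∸ k)
      first-summand with ℕₚ.m≤n⇒m<n∨m≡n k≤m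
      ... | inj₂ ≡.refl = trans
        (x≈0⇒x*y≈0 _ (x≈0⇒x*y≈0 _ (m<k⇒gauss≈0 {m} ℕₚ.≤-refl)))
        (sym (y≈0⇒x*y≈0 _ (trans (reflexive (≡.cong (qint q) (ℕₚ.n∸n≡0 m))) (qint-0 q))))
      ... | inj₁ k<m = begin
        gauss m (suc k) * qfact q (suc k) * qfact q (m ∸ k)
          ≈⟨ *-congˡ (reflexive (≡.cong (qfact q) m∸k≡1+m∸[1+k])) ⟩
        gauss m (suc k) * qfact q (suc k) * (qfact q (m ∸ suc k) * qint q (suc (m ∸ suc k)))
          ≈⟨ sym (*-assoc _ _ _) ⟩
        gauss m (suc k) * qfact q (suc k) * qfact q (m ∸ suc k) * qint q (suc (m ∸ suc k))
          ≈⟨ *-cong (gauss*qfact*qfact k<m) (reflexive (≡.cong (qint q) (≡.sym m∸k≡1+m∸[1+k]))) ⟩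
        qfact q m * qint q (m ∸ k) ∎
        where
        m∸k≡1+m∸[1+k] : m ∸ k ≡.≡ suc (m ∸ suc k)
        m∸k≡1+m∸[1+k] = ℕₚ.+-∸-assoc 1 k<m

    vandermondeTerm : ℕ → ℕ → ℕ → ℕ → Carrier
    vandermondeTerm i j n k = pow (pow q k) (j ∸ (n ∸ k)) * gauss i k * gauss j (n ∸ k)

    q-vandermonde : ∀ i j n → gauss (i ℕ.+ j) n ≈ sumTo n (vandermondeTerm i j n)
    q-vandermonde zero j n = sym (begin
      sumTo n (vandermondeTerm 0 j n)
        ≈⟨ sumBelow-head n _ ⟩
      vandermondeTerm 0 j n 0 + sumBelow n (λ k → vandermondeTerm 0 j n (suc k))
        ≈⟨ +-cong (trans (*-congʳ (trans (*-identityʳ _) (pow-1# (j ∸ n)))) (*-identityˡ _))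
                  (sumBelow-zero n (λ k _ → x≈0⇒x*y≈0 _ (zeroʳ _))) ⟩
      gauss j n + 0#
        ≈⟨ +-identityʳ _ ⟩
      gauss j n ∎)
    q-vandermonde (suc i) j zero = sym
      (trans (+-identityˡ _) (trans (*-identityʳ _) (trans (*-identityʳ _) (pow-1# j))))
    q-vandermonde (suc i) j (suc n) = begin
      gauss (i ℕ.+ j) (suc n) + pow q (i ℕ.+ j ∸ n) * gauss (i ℕ.+ j) n
        ≈⟨ +-cong (trans (q-vandermonde i j (suc n)) (sumBelow-head (suc n) _))
                  (trans (*-congˡ (q-vandermonde i j n)) (*-distribˡ-sumBelow (suc n) _ _)) ⟩
      (T i (suc n) 0 + sumTo n (λ k → T i (suc n) (suc k)))
        + sumTo n (λ k → pow q (i ℕ.+ j ∸ n) * T i n k)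
        ≈⟨ trans (+-assoc _ _ _) (+-congˡ (sym (sumBelow-+ (suc n) _ _))) ⟩
      T i (suc n) 0 + sumTo n (λ k → T i (suc n) (suc k) + pow q (i ℕ.+ j ∸ n) * T i n k)
        ≈⟨ +-congˡ (sumBelow-cong (suc n) (λ k k≤n → pascal k (ℕₚ.≤-pred k≤n))) ⟩
      T (suc i) (suc n) 0 + sumTo n (λ k → T (suc i) (suc n) (suc k))
        ≈⟨ sym (sumBelow-head (suc n) _) ⟩
      sumTo (suc n) (T (suc i) (suc n)) ∎
      where
      T : ℕ → ℕ → ℕ → Carrier
      T i′ = vandermondeTerm i′ j

      q^[i+j∸n]*term : ∀ k → k ≤ n → pow q (i ℕ.+ j ∸ n) * T i n k
                  ≈ pow (pow q (suc k)) (j ∸ (n ∸ k)) * (pow q (i ∸ k) * gauss i k) * gauss j (n ∸ k)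
      q^[i+j∸n]*term k k≤n with ℕₚ.≤-<-connex k i | ℕₚ.≤-<-connex (n ∸ k) j
      ... | inj₂ i<k | _ = trans
        (y≈0⇒x*y≈0 _ (x≈0⇒x*y≈0 _ (y≈0⇒x*y≈0 _ (m<k⇒gauss≈0 i<k))))
        (sym (x≈0⇒x*y≈0 _ (y≈0⇒x*y≈0 _ (y≈0⇒x*y≈0 _ (m<k⇒gauss≈0 i<k)))))
      ... | inj₁ _ | inj₂ j<l = trans
        (y≈0⇒x*y≈0 _ (y≈0⇒x*y≈0 _ (m<k⇒gauss≈0 j<l)))
        (sym (y≈0⇒x*y≈0 _ (m<k⇒gauss≈0 j<l)))
      ... | inj₁ k≤i | inj₁ l≤j = begin
        pow q (i ℕ.+ j ∸ n) * (pow (pow q k) b * gauss i k * gauss j (n ∸ k))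
          ≈⟨ *-congʳ (trans (reflexive (≡.cong (pow q) i+j∸n≡a+b)) (pow-+ q (i ∸ k) b)) ⟩
        (pow q (i ∸ k) * pow q b) * (pow (pow q k) b * gauss i k * gauss j (n ∸ k))
          ≈⟨ solve 5 (λ a p Q g g′ → (a :* p) :* (Q :* g :* g′) := (p :* Q) :* (a :* g) :* g′)
                   refl _ _ _ _ _ ⟩
        (pow q b * pow (pow q k) b) * (pow q (i ∸ k) * gauss i k) * gauss j (n ∸ k)
          ≈⟨ *-congʳ (*-congʳ (sym (pow-* q (pow q k) b))) ⟩
        pow (pow q (suc k)) b * (pow q (i ∸ k) * gauss i k) * gauss j (n ∸ k) ∎
        where
        b = j ∸ (n ∸ k)
        i+j∸n≡a+b = [i+j]∸n≡[i∸k]+[j∸[n∸k]] k≤i k≤n l≤j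

      pascal : ∀ k → k ≤ n →
               T i (suc n) (suc k) + pow q (i ℕ.+ j ∸ n) * T i n k ≈ T (suc i) (suc n) (suc k)
      pascal k k≤n = trans (+-congˡ (q^[i+j∸n]*term k k≤n))
        (solve 5 (λ Q g₁ p g₀ g′ → Q :* g₁ :* g′ :+ Q :* (p :* g₀) :* g′
                                 := Q :* (g₁ :+ p :* g₀) :* g′)
               refl _ _ _ _ _)

  module QCalculus (q : Carrier) (q≉1 : ¬ q ≈ 1#) ([n]≉0 : ∀ n → 1 ≤ n → ¬ qint q n ≈ 0#) where
    open GaussianBinomial q

    1-q≉0 : ¬ 1# - q ≈ 0#
    1-q≉0 1-q≈0 = q≉1 (sym (x∙y⁻¹≈ε⇒x≈y 1# q 1-q≈0))

    [1-q]*[n]≈1-qⁿ : ∀ n → (1# - q) * qint q n ≈ 1# - pow q n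
    [1-q]*[n]≈1-qⁿ n = begin
      (1# - q) * ((1# - pow q n) * (1# - q) ⁻¹)   ≈⟨ x∙yz≈y∙xz _ _ _ ⟩
      (1# - pow q n) * ((1# - q) * (1# - q) ⁻¹)   ≈⟨ *-congˡ (⁻¹-inverse _ 1-q≉0) ⟩
      (1# - pow q n) * 1#                         ≈⟨ *-identityʳ _ ⟩
      1# - pow q n                                ∎

    qfact≉0 : ∀ m → ¬ qfact q m ≈ 0#
    qfact≉0 zero    1≈0 = 0≉1 (sym 1≈0)
    qfact≉0 (suc m)     = x≉0∧y≉0⇒x*y≉0 (qfact≉0 m) ([n]≉0 (suc m) (s≤s z≤n))

    qfact⁻¹ : ℕ → Carrier
    qfact⁻¹ m = qfact q m ⁻¹

    qfact*qfact⁻¹≈1 : ∀ m → qfact q m * qfact⁻¹ m ≈ 1#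
    qfact*qfact⁻¹≈1 m = ⁻¹-inverse _ (qfact≉0 m)

    qfact⁻¹-suc : ∀ m → qfact⁻¹ (suc m) * qint q (suc m) ≈ qfact⁻¹ m
    qfact⁻¹-suc m = begin
      qfact⁻¹ (suc m) * qint q (suc m)
        ≈⟨ sym (*-identityʳ _) ⟩
      qfact⁻¹ (suc m) * qint q (suc m) * 1#
        ≈⟨ *-congˡ (sym (qfact*qfact⁻¹≈1 m)) ⟩
      qfact⁻¹ (suc m) * qint q (suc m) * (qfact q m * qfact⁻¹ m)
        ≈⟨ solve 4 (λ a i f b → a :* i :* (f :* b) := (f :* i) :* a :* b) refl _ _ _ _ ⟩
      qfact q (suc m) * qfact⁻¹ (suc m) * qfact⁻¹ m
        ≈⟨ trans (*-congʳ (qfact*qfact⁻¹≈1 (suc m))) (*-identityˡ _) ⟩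
      qfact⁻¹ m ∎

    qfact⁻¹*qbinom : ∀ n k → qfact⁻¹ n * qbinom q n k ≈ qfact⁻¹ k * qfact⁻¹ (n ∸ k)
    qfact⁻¹*qbinom n k = begin
      qfact⁻¹ n * (qfact q n * qfact⁻¹ k * qfact⁻¹ (n ∸ k))
        ≈⟨ solve 4 (λ a f b c → a :* (f :* b :* c) := (f :* a) :* (b :* c)) refl _ _ _ _ ⟩
      (qfact q n * qfact⁻¹ n) * (qfact⁻¹ k * qfact⁻¹ (n ∸ k))
        ≈⟨ trans (*-congʳ (qfact*qfact⁻¹≈1 n)) (*-identityˡ _) ⟩
      qfact⁻¹ k * qfact⁻¹ (n ∸ k) ∎

    qbinom≈gauss : ∀ {m k} → k ≤ m → qbinom q m k ≈ gauss m k
    qbinom≈gauss {m} {k} k≤m = begin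
      qfact q m * qfact⁻¹ k * qfact⁻¹ (m ∸ k)
        ≈⟨ *-congʳ (*-congʳ (sym (gauss*qfact*qfact k≤m))) ⟩
      gauss m k * qfact q k * qfact q (m ∸ k) * qfact⁻¹ k * qfact⁻¹ (m ∸ k)
        ≈⟨ solve 5 (λ g f f′ b b′ → g :* f :* f′ :* b :* b′ := g :* (f :* b) :* (f′ :* b′))
                 refl _ _ _ _ _ ⟩
      gauss m k * (qfact q k * qfact⁻¹ k) * (qfact q (m ∸ k) * qfact⁻¹ (m ∸ k))
        ≈⟨ *-cong (*-congˡ (qfact*qfact⁻¹≈1 k)) (qfact*qfact⁻¹≈1 (m ∸ k)) ⟩
      gauss m k * 1# * 1#
        ≈⟨ trans (*-identityʳ _) (*-identityʳ _) ⟩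
      gauss m k ∎

    qfact⁻¹*qfact⁻¹≈gauss*qfact⁻¹ : ∀ {m k} → k ≤ m →
                                    qfact⁻¹ k * qfact⁻¹ (m ∸ k) ≈ gauss m k * qfact⁻¹ m
    qfact⁻¹*qfact⁻¹≈gauss*qfact⁻¹ {m} {k} k≤m =
      trans (sym (qfact⁻¹*qbinom m k)) (trans (*-congˡ (qbinom≈gauss k≤m)) (*-comm _ _))

    expq : Carrier → Series
    expq w m = pow w m * qfact⁻¹ m

    eqSeries-1≈expq : ∀ w m → eqSeries q w 1# m ≈ expq w m
    eqSeries-1≈expq w m = *-congʳ (trans (*-congʳ (pow-1# (m C 2))) (*-identityˡ _))

    expq-cong : ∀ {w w′} → w ≈ w′ → ∀ m → expq w m ≈ expq w′ m
    expq-cong w≈w′ m = *-congʳ (pow-congˡ m w≈w′)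

    expq-q-difference : ∀ w m → expq w m + - ((1# - q) * w) * shift 1 (expq w) m ≈ expq (q * w) m
    expq-q-difference w zero    = trans (+-congˡ (zeroʳ _)) (+-identityʳ _)
    expq-q-difference w (suc m) = begin
      A + - ((1# - q) * w) * expq w m
        ≈⟨ +-congˡ (sym (-‿distribˡ-* _ _)) ⟩
      A - (1# - q) * w * expq w m
        ≈⟨ +-congˡ (-‿cong A[1-qᵐ⁺¹]) ⟩
      A - A * (1# - pow q (suc m))
        ≈⟨ +-congˡ (-‿cong (trans (x[y-z]≈xy-xz A 1# _) (+-congʳ (*-identityʳ A)))) ⟩
      A - (A - A * pow q (suc m))
        ≈⟨ x-[x-y]≈y A _ ⟩
      A * pow q (suc m)
        ≈⟨ xy∙z≈zx∙y _ _ _ ⟩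
      pow q (suc m) * pow w (suc m) * qfact⁻¹ (suc m)
        ≈⟨ *-congʳ (sym (pow-* q w (suc m))) ⟩
      expq (q * w) (suc m) ∎
      where
      A = expq w (suc m)
      A[1-qᵐ⁺¹] : (1# - q) * w * expq w m ≈ A * (1# - pow q (suc m))
      A[1-qᵐ⁺¹] = begin
        (1# - q) * w * (pow w m * qfact⁻¹ m)
          ≈⟨ *-congˡ (*-congˡ (sym (qfact⁻¹-suc m))) ⟩
        (1# - q) * w * (pow w m * (qfact⁻¹ (suc m) * qint q (suc m)))
          ≈⟨ solve 5 (λ a w p f i → a :* w :* (p :* (f :* i)) := w :* p :* f :* (a :* i))
                   refl _ _ _ _ _ ⟩
        A * ((1# - q) * qint q (suc m))
          ≈⟨ *-congˡ ([1-q]*[n]≈1-qⁿ (suc m)) ⟩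
        A * (1# - pow q (suc m)) ∎

    expq-·-qpochSeries : ∀ z k m → (expq z · qpochSeries ((1# - q) * z) q k) m ≈ expq (pow q k * z) m
    expq-·-qpochSeries z zero    m =
      trans (·-identityʳ (expq z) m) (expq-cong (sym (*-identityˡ z)) m)
    expq-·-qpochSeries z (suc k) m = begin
      (expq z · (qpochSeries β q k · linearPoly cₖ)) m
        ≈⟨ ·-·-linearPoly (expq z) (qpochSeries β q k) cₖ m ⟩
      (expq z · qpochSeries β q k) m + cₖ * shift 1 (expq z · qpochSeries β q k) m
        ≈⟨ +-cong (expq-·-qpochSeries z k m)
                  (*-cong (-‿cong (x∙yz≈y∙xz _ _ _)) (shift-cong 1 (expq-·-qpochSeries z k) m)) ⟩
      expq w m + - ((1# - q) * w) * shift 1 (expq w) m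
        ≈⟨ expq-q-difference w m ⟩
      expq (q * w) m
        ≈⟨ expq-cong (sym (*-assoc q (pow q k) z)) m ⟩
      expq (pow q (suc k) * z) m ∎
      where
      β = (1# - q) * z
      cₖ = - (pow q k * β)
      w = pow q k * z

    module Rogers (z : Carrier) where

      β : Carrier
      β = (1# - q) * z

      block : ℕ → ℕ → Series2
      block k l = mono 1# k l ⊗ qpochS β q k

      block-separable : ∀ k l → Separable (block k l) (δ k) (shift l (qpochSeries β q k))
      block-separable k l i j = trans
        (⊗-separable (mono-separable 1# k l) (qpochS-separable β q k) i j)
        (*-cong (·-identityʳ (δ k) i)
                (trans (·-cong {g = qpochSeries β q k} (λ m → *-identityˡ (δ l m)) (λ _ → refl) j)
                       (δ-· l (qpochSeries β q k) j)))

      rogersPoly : ℕ → Series2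
      rogersPoly n = sumTo2 n (λ k → scale (qbinom q n k) (block k (n ∸ k)))

      rogersPoly-summable : Summable rogersPoly
      rogersPoly-summable n i j i+j<n = sumBelow-zero (suc n) (λ k _ →
        y≈0⇒x*y≈0 _ (trans (block-separable k (n ∸ k) i j) (term k)))
        where
        term : ∀ k → δ k i * shift (n ∸ k) (qpochSeries β q k) j ≈ 0#
        term k with i ℕ.≡ᵇ k | ℕₚ.≡ᵇ⇒≡ i k
        ... | false | _   = zeroˡ _
        ... | true  | i≡k = y≈0⇒x*y≈0 _ (reflexive (shift-< (n ∸ k) _
                              (≡.subst (λ i → j < n ∸ i) (i≡k _) (i+j<n⇒j<n∸i i+j<n))))

      expq² : Series2
      expq² i j = expq z i * expq z j

      inT⊗inS≈expq² : ∀ i j → (inT (eqSeries q z 1#) ⊗ inS (eqSeries q z 1#)) i j ≈ expq² i j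
      inT⊗inS≈expq² i j = trans
        (⊗-separable (inT-separable (eqSeries q z 1#)) (inS-separable (eqSeries q z 1#)) i j)
        (*-cong (trans (·-identityʳ (eqSeries q z 1#) i) (eqSeries-1≈expq z i))
                (trans (·-identityˡ (eqSeries q z 1#) j) (eqSeries-1≈expq z j)))

      expq²⊗block : ∀ k l i j →
        (expq² ⊗ block k l) i j ≈ shift k (expq z) i * shift l (expq (pow q k * z)) j
      expq²⊗block k l i j = trans
        (⊗-separable {A = expq²} {f₁ = expq z} {g₁ = expq z} (λ _ _ → refl) (block-separable k l) i j)
        (*-cong (·-δʳ (expq z) k i)
                (trans (·-shiftʳ l (expq z) _ j) (shift-cong l (expq-·-qpochSeries z k) j)))

      block-coefficient : ∀ i j n k → k ≤ n →
        qfact⁻¹ n * (qbinom q n k * (shift k (expq z) i * shift (n ∸ k) (expq (pow q k * z)) j))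
          ≈ vandermondeTerm i j n k * (pow z (i ℕ.+ j ∸ n) * qfact⁻¹ i * qfact⁻¹ j)
      block-coefficient i j n k k≤n with ℕₚ.≤-<-connex k i | ℕₚ.≤-<-connex (n ∸ k) j
      ... | inj₂ i<k | _ = trans
        (y≈0⇒x*y≈0 _ (y≈0⇒x*y≈0 _ (x≈0⇒x*y≈0 _ (reflexive (shift-< k _ i<k)))))
        (sym (x≈0⇒x*y≈0 _ (x≈0⇒x*y≈0 _ (y≈0⇒x*y≈0 _ (m<k⇒gauss≈0 i<k)))))
      ... | inj₁ _ | inj₂ j<l = trans
        (y≈0⇒x*y≈0 _ (y≈0⇒x*y≈0 _ (y≈0⇒x*y≈0 _ (reflexive (shift-< (n ∸ k) _ j<l)))))
        (sym (x≈0⇒x*y≈0 _ (y≈0⇒x*y≈0 _ (m<k⇒gauss≈0 j<l))))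
      ... | inj₁ k≤i | inj₁ l≤j = begin
        qfact⁻¹ n * (qbinom q n k * (shift k (expq z) i * shift l (expq (pow q k * z)) j))
          ≈⟨ trans (sym (*-assoc _ _ _))
                   (*-cong (qfact⁻¹*qbinom n k)
                           (*-cong (reflexive (shift-≤ k _ k≤i)) (reflexive (shift-≤ l _ l≤j)))) ⟩
        (qfact⁻¹ k * qfact⁻¹ l) * (expq z a * expq (pow q k * z) b)
          ≈⟨ *-congˡ (*-congˡ (*-congʳ (pow-* (pow q k) z b))) ⟩
        (qfact⁻¹ k * qfact⁻¹ l) * (pow z a * qfact⁻¹ a * (pow (pow q k) b * pow z b * qfact⁻¹ b))
          ≈⟨ solve 7 (λ K L zᵃ A Q zᵇ B → (K :* L) :* (zᵃ :* A :* (Q :* zᵇ :* B))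
                                        := Q :* (K :* A) :* (L :* B) :* (zᵃ :* zᵇ))
                   refl _ _ _ _ _ _ _ ⟩
        pow (pow q k) b * (qfact⁻¹ k * qfact⁻¹ a) * (qfact⁻¹ l * qfact⁻¹ b) * (pow z a * pow z b)
          ≈⟨ *-cong (*-cong (*-congˡ (qfact⁻¹*qfact⁻¹≈gauss*qfact⁻¹ k≤i))
                            (qfact⁻¹*qfact⁻¹≈gauss*qfact⁻¹ l≤j))
                    (trans (sym (pow-+ z a b)) (reflexive (≡.cong (pow z) (≡.sym i+j∸n≡a+b)))) ⟩
        pow (pow q k) b * (gauss i k * qfact⁻¹ i) * (gauss j l * qfact⁻¹ j) * pow z (i ℕ.+ j ∸ n)
          ≈⟨ solve 6 (λ Q g I g′ J Z → Q :* (g :* I) :* (g′ :* J) :* Z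
                                     := Q :* g :* g′ :* (Z :* I :* J))
                   refl _ _ _ _ _ _ ⟩
        vandermondeTerm i j n k * (pow z (i ℕ.+ j ∸ n) * qfact⁻¹ i * qfact⁻¹ j) ∎
        where
        l = n ∸ k
        a = i ∸ k
        b = j ∸ l
        i+j∸n≡a+b = [i+j]∸n≡[i∸k]+[j∸[n∸k]] k≤i k≤n l≤j

      qfact⁻¹*expq²⊗rogersPoly : ∀ i j n → n ≤ i ℕ.+ j →
        qfact⁻¹ n * (expq² ⊗ rogersPoly n) i j
          ≈ qbinom q (i ℕ.+ j) n * (pow z (i ℕ.+ j ∸ n) * qfact⁻¹ i * qfact⁻¹ j)
      qfact⁻¹*expq²⊗rogersPoly i j n n≤i+j = begin
        qfact⁻¹ n * (expq² ⊗ rogersPoly n) i j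
          ≈⟨ trans (*-congˡ (⊗-sumTo2 expq² n (λ k → scale (qbinom q n k) (block k (n ∸ k))) i j))
                   (*-distribˡ-sumBelow (suc n) _ _) ⟩
        sumTo n (λ k → qfact⁻¹ n * (expq² ⊗ scale (qbinom q n k) (block k (n ∸ k))) i j)
          ≈⟨ sumBelow-cong (suc n) (λ k k≤n → trans
               (*-congˡ (trans (⊗-scaleʳ expq² (block k (n ∸ k)) (qbinom q n k) i j)
                               (*-congˡ (expq²⊗block k (n ∸ k) i j))))
               (block-coefficient i j n k (ℕₚ.≤-pred k≤n))) ⟩
        sumTo n (λ k → vandermondeTerm i j n k * Z)
          ≈⟨ sym (*-distribʳ-sumBelow (suc n) Z _) ⟩
        sumTo n (vandermondeTerm i j n) * Z
          ≈⟨ *-congʳ (sym (q-vandermonde i j n)) ⟩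
        gauss (i ℕ.+ j) n * Z
          ≈⟨ *-congʳ (sym (qbinom≈gauss n≤i+j)) ⟩
        qbinom q (i ℕ.+ j) n * Z ∎
        where
        Z = pow z (i ℕ.+ j ∸ n) * qfact⁻¹ i * qfact⁻¹ j

      rogers : ∀ (y : Carrier) (P : ℕ → Carrier) i j →
        sumTo (i ℕ.+ j) (λ k → qbinom q (i ℕ.+ j) k * P k * pow y k * pow z (i ℕ.+ j ∸ k))
          * qfact⁻¹ i * qfact⁻¹ j
          ≈ ((inT (eqSeries q z 1#) ⊗ inS (eqSeries q z 1#))
              ⊗ sumFam2 (λ n → scale (P n * pow y n * qfact⁻¹ n) (rogersPoly n))) i j
      rogers y P i j = begin
        sumTo N T * qfact⁻¹ i * qfact⁻¹ j
          ≈⟨ trans (*-congʳ (*-distribʳ-sumBelow (suc N) _ T)) (*-distribʳ-sumBelow (suc N) _ _) ⟩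
        sumTo N (λ n → T n * qfact⁻¹ i * qfact⁻¹ j)
          ≈⟨ sumBelow-cong (suc N) (λ n n≤N → coefficient n (ℕₚ.≤-pred n≤N)) ⟩
        sumTo N (λ n → (expq² ⊗ inner n) i j)
          ≈⟨ sym (⊗-sumFam2 expq² inner inner-summable i j) ⟩
        (expq² ⊗ sumFam2 inner) i j
          ≈⟨ sym (⊗-cong {B = sumFam2 inner} inT⊗inS≈expq² (λ _ _ → refl) i j) ⟩
        ((inT (eqSeries q z 1#) ⊗ inS (eqSeries q z 1#)) ⊗ sumFam2 inner) i j ∎
        where
        N = i ℕ.+ j
        T : ℕ → Carrier
        T k = qbinom q N k * P k * pow y k * pow z (N ∸ k)
        inner : ℕ → Series2
        inner n = scale (P n * pow y n * qfact⁻¹ n) (rogersPoly n)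
        inner-summable : Summable inner
        inner-summable n i j i+j<n = y≈0⇒x*y≈0 _ (rogersPoly-summable n i j i+j<n)
        coefficient : ∀ n → n ≤ N → T n * qfact⁻¹ i * qfact⁻¹ j ≈ (expq² ⊗ inner n) i j
        coefficient n n≤N = begin
          qbinom q N n * P n * pow y n * pow z (N ∸ n) * qfact⁻¹ i * qfact⁻¹ j
            ≈⟨ solve 6 (λ B p Y Z I J → B :* p :* Y :* Z :* I :* J
                                      := p :* Y :* (B :* (Z :* I :* J)))
                     refl _ _ _ _ _ _ ⟩
          P n * pow y n * (qbinom q N n * (pow z (N ∸ n) * qfact⁻¹ i * qfact⁻¹ j))
            ≈⟨ *-congˡ (sym (qfact⁻¹*expq²⊗rogersPoly i j n n≤N)) ⟩
          P n * pow y n * (qfact⁻¹ n * (expq² ⊗ rogersPoly n) i j)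
            ≈⟨ sym (*-assoc _ _ _) ⟩
          P n * pow y n * qfact⁻¹ n * (expq² ⊗ rogersPoly n) i j
            ≈⟨ sym (⊗-scaleʳ expq² (rogersPoly n) _ i j) ⟩
          (expq² ⊗ inner n) i j ∎

-- The identity holds for every sequence P.
theorem17 : ∀ {c ℓ} (F : Field c ℓ) →
    let open Field F
        open FieldDefs F
    in (q u x y z : Carrier) (a P : ℕ → Carrier) →
       ¬ (q ≈ 1#) →
       (∀ n → 1 ≤ n → ¬ (qint q n ≈ 0#)) →
       ¬ (a 0 ≈ 0#) →
       -- A_q(t) e_q(t x, u) = Σ_n P_n t^n / [n]_q!
       (∀ n → P n * ((qfact q n) ⁻¹) ≈ ((λ k → a k * ((qfact q k) ⁻¹)) · eqSeries q x u) n) →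
       let Q : ℕ → Carrier
           Q n = sumTo n (λ k → qbinom q n k * P k * pow y k * pow z (n ∸ k))
           lhs : Series2
           lhs i j = Q (i ℕ.+ j) * ((qfact q i) ⁻¹) * ((qfact q j) ⁻¹)
           inner : ℕ → Series2
           inner n = scale (P n * pow y n * ((qfact q n) ⁻¹))
                       (sumTo2 n (λ k → scale (qbinom q n k)
                                          (mono 1# k (n ∸ k) ⊗ qpochS ((1# - q) * z) q k)))
           rhs : Series2
           rhs = (inT (eqSeries q z 1#) ⊗ inS (eqSeries q z 1#)) ⊗ sumFam2 inner
       in ∀ i j → lhs i j ≈ rhs i j
theorem17 F q u x y z a P q≉1 [n]≉0 _ _ = QCalculus.Rogers.rogers F q q≉1 [n]≉0 z y P
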